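{- Let $\mathbf A$ be a Łukasiewicz semiring and $I\subseteq A$ with $0\in I$. Then $I$ is the $0$-class $[0]_\theta$ of some congruence $\theta$ of $\mathbf A$ if and only if $I$ satisfies: (I1) if $ab^{\alpha}\in I$ and $b\in I$ then $a\in I$; and (I2) if $a^{\alpha}b\in I$ and $b^{\alpha}a\in I$ then $(ac)^{\alpha}(bc)\in I$ and $(ca)^{\alpha}(cb)\in I$ for every $c\in A$. Moreover, in that case $I=[0]_{\theta(I)}$, where $a\,\theta(I)\,b$ iff $a^{\alpha}b,\,b^{\alpha}a\in I$.
   Context: An $\iota$-near semiring is an algebra $\langle A,+,\cdot,{}^{\alpha},0,1\rangle$ of type $\langle 2,2,1,0,0\rangle$ such that $\langle A,+\rangle$ is a join semilattice with least element $0$ and greatest element $1$ (order $x\le y$ iff $x+y=y$), $x\cdot1=x=1\cdot x$, $(x+y)\cdot z=xz+yz$, $x0=0x=0$, $(x^{\alpha})^{\alpha}=x$, and $x\le y$ implies $y^{\alpha}\le x^{\alpha}$. A Łukasiewicz near semiring is an $\iota$-near semiring satisfying $(x y^{\alpha})^{\alpha} y^{\alpha}=(y x^{\alpha})^{\alpha} x^{\alpha}$. A Łukasiewicz semiring is a Łukasiewicz near semiring in which $\cdot$ is associative. Juxtaposition $xy$ denotes $x\cdot y$. -}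

module Defs where

open import Level using (Level; suc; _⊔_)
open import Relation.Binary.PropositionalEquality using (_≡_)
open import Relation.Binary.Core using (Rel)
open import Relation.Binary.Structures using (IsEquivalence)
open import Relation.Unary using (Pred; _∈_)
open import Data.Product using (_×_)

record IotaNearSemiring (a : Level) : Set (suc a) where
  infixl 6 _+_
  infixl 7 _·_
  infix 4 _≤_
  field
    Carrier : Set a
    _+_ : Carrier → Carrier → Carrier
    _·_ : Carrier → Carrier → Carrier
    _ᵅ : Carrier → Carrier
    𝟘 : Carrier
    𝟙 : Carrier

  _≤_ : Carrier → Carrier → Set a
  x ≤ y = x + y ≡ y

  field
    +-assoc : ∀ x y z → (x + y) + z ≡ x + (y + z)
    +-comm  : ∀ x y → x + y ≡ y + x
    +-idem  : ∀ x → x + x ≡ x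
    𝟘-least    : ∀ x → 𝟘 ≤ x
    𝟙-greatest : ∀ x → x ≤ 𝟙
    ·-identityʳ : ∀ x → x · 𝟙 ≡ x
    ·-identityˡ : ∀ x → 𝟙 · x ≡ x
    ·-distribʳ-+ : ∀ x y z → (x + y) · z ≡ x · z + y · z
    ·-zeroʳ : ∀ x → x · 𝟘 ≡ 𝟘
    ·-zeroˡ : ∀ x → 𝟘 · x ≡ 𝟘
    ᵅ-involutive : ∀ x → (x ᵅ) ᵅ ≡ x
    ᵅ-antitone   : ∀ {x y} → x ≤ y → y ᵅ ≤ x ᵅ

record LukasiewiczNearSemiring (a : Level) : Set (suc a) where
  field
    ιNearSemiring : IotaNearSemiring a
  open IotaNearSemiring ιNearSemiring public
  field
    lukasiewicz : ∀ x y → ((x · (y ᵅ)) ᵅ) · (y ᵅ) ≡ ((y · (x ᵅ)) ᵅ) · (x ᵅ)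

record LukasiewiczSemiring (a : Level) : Set (suc a) where
  field
    lukasiewiczNearSemiring : LukasiewiczNearSemiring a
  open LukasiewiczNearSemiring lukasiewiczNearSemiring public
  field
    ·-assoc : ∀ x y z → (x · y) · z ≡ x · (y · z)

module _ {a : Level} (A : LukasiewiczSemiring a) where
  open LukasiewiczSemiring A

  -- A congruence of the algebra ⟨A,+,·,α,0,1⟩: an equivalence relation
  -- compatible with all fundamental operations (constants are trivially compatible).
  record IsCongruence {ℓ : Level} (θ : Rel Carrier ℓ) : Set (a ⊔ ℓ) where
    field
      isEquivalence : IsEquivalence θ
      +-cong : ∀ {x y u v} → θ x y → θ u v → θ (x + u) (y + v)
      ·-cong : ∀ {x y u v} → θ x y → θ u v → θ (x · u) (y · v)
      ᵅ-cong : ∀ {x y} → θ x y → θ (x ᵅ) (y ᵅ)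

  zeroClass : {ℓ : Level} → Rel Carrier ℓ → Pred Carrier ℓ
  zeroClass θ x = θ x 𝟘

  _≐_ : {ℓ ℓ' : Level} → Pred Carrier ℓ → Pred Carrier ℓ' → Set (a ⊔ ℓ ⊔ ℓ')
  P ≐ Q = ∀ x → (x ∈ P → x ∈ Q) × (x ∈ Q → x ∈ P)

  I1 : {ℓ : Level} → Pred Carrier ℓ → Set (a ⊔ ℓ)
  I1 I = ∀ x y → (x · (y ᵅ)) ∈ I → y ∈ I → x ∈ I

  I2 : {ℓ : Level} → Pred Carrier ℓ → Set (a ⊔ ℓ)
  I2 I = ∀ x y → ((x ᵅ) · y) ∈ I → ((y ᵅ) · x) ∈ I →
         ∀ c → (((x · c) ᵅ) · (y · c)) ∈ I × (((c · x) ᵅ) · (c · y)) ∈ I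

  θ[_] : {ℓ : Level} → Pred Carrier ℓ → Rel Carrier ℓ
  θ[ I ] x y = ((x ᵅ) · y) ∈ I × ((y ᵅ) · x) ∈ I

module Submission where

-- In a Łukasiewicz near semiring the term  x ⊓ y = (xᵅ·y)ᵅ·y  is commutative
-- (this is the Łukasiewicz identity) and is the meet for the semilattice order;
-- moreover x ≤ y holds exactly when yᵅ·x = 0, and the join is definable by
-- De Morgan, x + y = (xᵅ ⊓ yᵅ)ᵅ.  Hence every relation compatible with · and ᵅ
-- is automatically compatible with +.
--
-- The
-- forward direction of the theorem holds because a congruence θ is determined by
-- its 0-class: x θ y iff xᵅy and yᵅx lie in [0]_θ, so [0]_θ inherits (I1) and
-- (I2).  Conversely, (I1) makes I a down-set closed under p ⊕ q = (pᵅqᵅ)ᵅ; from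
-- this θ(I) is an equivalence, (I2) gives compatibility with · and ᵅ, the De
-- Morgan law gives compatibility with +, and [0]_θ(I) = I because 0ᵅ·x = x.

open import Defs
open import Level using (Level)
open import Relation.Unary using (Pred; _∈_)
open import Relation.Binary.Core using (Rel)
open import Relation.Binary.Bundles using (Poset)
import Relation.Binary.Reasoning.PartialOrder as PosetReasoning
open import Relation.Binary.Structures using (IsEquivalence)
open import Data.Product using (_×_; Σ; _,_; proj₁; proj₂)
open import Function.Bundles using (_⇔_; mk⇔)
open import Relation.Binary.PropositionalEquality
  using (_≡_; refl; sym; trans; cong; subst; subst₂; module ≡-Reasoning)
  renaming (isEquivalence to ≡-isEquivalence)

module IotaOrder {a : Level} (N : IotaNearSemiring a) where
  open IotaNearSemiring N

  ≤-reflexive : ∀ {x y} → x ≡ y → x ≤ y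
  ≤-reflexive {x} refl = +-idem x

  ≤-antisym : ∀ {x y} → x ≤ y → y ≤ x → x ≡ y
  ≤-antisym {x} {y} p q = trans (sym q) (trans (+-comm y x) p)

  ≤-trans : ∀ {x y z} → x ≤ y → y ≤ z → x ≤ z
  ≤-trans {x} {y} {z} p q = trans (cong (x +_) (sym q))
    (trans (sym (+-assoc x y z)) (trans (cong (_+ z) p) q))

  ≤-poset : Poset a a a
  ≤-poset = record
    { isPartialOrder = record
      { isPreorder = record
        { isEquivalence = ≡-isEquivalence ; reflexive = ≤-reflexive ; trans = ≤-trans }
      ; antisym = ≤-antisym } }

  module ≤-Reasoning = PosetReasoning ≤-poset

  ≤𝟘⇒≡𝟘 : ∀ {x} → x ≤ 𝟘 → x ≡ 𝟘
  ≤𝟘⇒≡𝟘 {x} p = ≤-antisym p (𝟘-least x)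

  x≤x+y : ∀ x y → x ≤ x + y
  x≤x+y x y = trans (sym (+-assoc x x y)) (cong (_+ y) (+-idem x))

  y≤x+y : ∀ x y → y ≤ x + y
  y≤x+y x y = subst (y ≤_) (+-comm y x) (x≤x+y y x)

  +-lub : ∀ {x y z} → x ≤ z → y ≤ z → x + y ≤ z
  +-lub {x} {y} {z} p q = trans (+-assoc x y z) (trans (cong (x +_) q) p)

  ᵅ-swapʳ : ∀ {x y} → x ≤ y ᵅ → y ≤ x ᵅ
  ᵅ-swapʳ {x} {y} p = subst (_≤ x ᵅ) (ᵅ-involutive y) (ᵅ-antitone p)

  ᵅ-swapˡ : ∀ {x y} → x ᵅ ≤ y → y ᵅ ≤ x
  ᵅ-swapˡ {x} {y} p = subst (y ᵅ ≤_) (ᵅ-involutive x) (ᵅ-antitone p)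

  𝟘ᵅ≡𝟙 : 𝟘 ᵅ ≡ 𝟙
  𝟘ᵅ≡𝟙 = ≤-antisym (𝟙-greatest (𝟘 ᵅ)) (ᵅ-swapʳ (𝟘-least (𝟙 ᵅ)))

  𝟘ᵅ·x≡x : ∀ x → 𝟘 ᵅ · x ≡ x
  𝟘ᵅ·x≡x x = trans (cong (_· x) 𝟘ᵅ≡𝟙) (·-identityˡ x)

  ·-monoˡ-≤ : ∀ {x y} z → x ≤ y → x · z ≤ y · z
  ·-monoˡ-≤ {x} {y} z p = trans (sym (·-distribʳ-+ x y z)) (cong (_· z) p)

  x·y≤y : ∀ x y → x · y ≤ y
  x·y≤y x y = subst (x · y ≤_) (·-identityˡ y) (·-monoˡ-≤ y (𝟙-greatest x))

module LukasiewiczLattice {a : Level} (L : LukasiewiczNearSemiring a) where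
  open LukasiewiczNearSemiring L
  open IotaOrder ιNearSemiring

  infixl 7 _⊓_
  _⊓_ : Carrier → Carrier → Carrier
  x ⊓ y = ((x ᵅ) · y) ᵅ · y

  ⊓-comm : ∀ x y → x ⊓ y ≡ y ⊓ x
  ⊓-comm x y = subst₂ (λ p q → ((x ᵅ · p) ᵅ) · p ≡ ((y ᵅ · q) ᵅ) · q)
    (ᵅ-involutive y) (ᵅ-involutive x) (lukasiewicz (x ᵅ) (y ᵅ))

  ⊓-lowerʳ : ∀ x y → x ⊓ y ≤ y
  ⊓-lowerʳ x y = x·y≤y _ y

  ⊓-lowerˡ : ∀ x y → x ⊓ y ≤ x
  ⊓-lowerˡ x y = subst (_≤ x) (⊓-comm y x) (⊓-lowerʳ y x)

  ·ᵅ-lowerˡ : ∀ x y → ((x · y ᵅ) ᵅ) · y ᵅ ≤ x ᵅ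
  ·ᵅ-lowerˡ x y = subst (_≤ x ᵅ) (sym (lukasiewicz x y)) (x·y≤y _ (x ᵅ))

  ᵅ·≡𝟘⇒⊓≡ : ∀ {x y} → (x ᵅ) · y ≡ 𝟘 → x ⊓ y ≡ y
  ᵅ·≡𝟘⇒⊓≡ {x} {y} e = trans (cong (λ t → t ᵅ · y) e) (𝟘ᵅ·x≡x y)

  xᵅ·x≡𝟘 : ∀ x → (x ᵅ) · x ≡ 𝟘
  xᵅ·x≡𝟘 x = begin
      (x ᵅ) · x          ≡⟨ cong (λ t → t ᵅ · x) (sym (𝟘ᵅ·x≡x x)) ⟩
      𝟘 ⊓ x              ≡⟨ ⊓-comm 𝟘 x ⟩
      ((x ᵅ) · 𝟘) ᵅ · 𝟘  ≡⟨ ·-zeroʳ _ ⟩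
      𝟘                  ∎
    where open ≡-Reasoning

  x·xᵅ≡𝟘 : ∀ x → x · (x ᵅ) ≡ 𝟘
  x·xᵅ≡𝟘 x = subst (λ t → t · (x ᵅ) ≡ 𝟘) (ᵅ-involutive x) (xᵅ·x≡𝟘 (x ᵅ))

  ᵅ·≡𝟘⇒≤ : ∀ {x y} → (y ᵅ) · x ≡ 𝟘 → x ≤ y
  ᵅ·≡𝟘⇒≤ {x} {y} e = subst (_≤ y) (ᵅ·≡𝟘⇒⊓≡ e) (⊓-lowerˡ y x)

  ≤⇒ᵅ·≡𝟘 : ∀ {x y} → x ≤ y → (y ᵅ) · x ≡ 𝟘
  ≤⇒ᵅ·≡𝟘 {x} {y} p = ≤𝟘⇒≡𝟘 (subst ((y ᵅ) · x ≤_) (xᵅ·x≡𝟘 x) (·-monoˡ-≤ x (ᵅ-antitone p)))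

  ≤⇒·ᵅ≡𝟘 : ∀ {x y} → x ≤ y → x · (y ᵅ) ≡ 𝟘
  ≤⇒·ᵅ≡𝟘 {x} {y} p = ≤𝟘⇒≡𝟘 (subst (x · (y ᵅ) ≤_) (x·xᵅ≡𝟘 y) (·-monoˡ-≤ (y ᵅ) p))

  ≤⇒⊓≡ : ∀ {x y} → x ≤ y → x ⊓ y ≡ x
  ≤⇒⊓≡ {x} {y} p = trans (⊓-comm x y) (ᵅ·≡𝟘⇒⊓≡ (≤⇒ᵅ·≡𝟘 p))

  ⊓-glb : ∀ {w x y} → w ≤ x → w ≤ y → w ≤ x ⊓ y
  ⊓-glb {w} {x} {y} p q = subst (_≤ x ⊓ y) (≤⇒⊓≡ q)
    (·-monoˡ-≤ y (ᵅ-antitone (·-monoˡ-≤ y (ᵅ-antitone p))))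

  +-deMorgan : ∀ x y → x + y ≡ ((x ᵅ) ⊓ (y ᵅ)) ᵅ
  +-deMorgan x y = ≤-antisym
    (+-lub (ᵅ-swapʳ (⊓-lowerˡ (x ᵅ) (y ᵅ))) (ᵅ-swapʳ (⊓-lowerʳ (x ᵅ) (y ᵅ))))
    (ᵅ-swapˡ (⊓-glb (ᵅ-antitone (x≤x+y x y)) (ᵅ-antitone (y≤x+y x y))))

  module Compatible {ℓ : Level} (θ : Rel Carrier ℓ)
    (·-cong : ∀ {x y u v} → θ x y → θ u v → θ (x · u) (y · v))
    (ᵅ-cong : ∀ {x y} → θ x y → θ (x ᵅ) (y ᵅ)) where

    ⊓-cong : ∀ {x y u v} → θ x y → θ u v → θ (x ⊓ u) (y ⊓ v)
    ⊓-cong h k = ·-cong (ᵅ-cong (·-cong (ᵅ-cong h) k)) k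

    +-cong : ∀ {x y u v} → θ x y → θ u v → θ (x + u) (y + v)
    +-cong {x} {y} {u} {v} h k = subst₂ θ (sym (+-deMorgan x u)) (sym (+-deMorgan y v))
      (ᵅ-cong (⊓-cong (ᵅ-cong h) (ᵅ-cong k)))

module Ideals {a : Level} (A : LukasiewiczSemiring a) where
  open LukasiewiczSemiring A
  open IotaOrder ιNearSemiring
  open LukasiewiczLattice lukasiewiczNearSemiring

  x·y≤x : ∀ x y → x · y ≤ x
  x·y≤x x y = ᵅ·≡𝟘⇒≤ (begin
      (x ᵅ) · (x · y)  ≡⟨ sym (·-assoc (x ᵅ) x y) ⟩
      ((x ᵅ) · x) · y  ≡⟨ cong (_· y) (xᵅ·x≡𝟘 x) ⟩
      𝟘 · y            ≡⟨ ·-zeroˡ y ⟩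
      𝟘                ∎)
    where open ≡-Reasoning

  -- Multiplication is monotone on the right: z x = (z (xᵅy)ᵅ) y ≤ z y when x ≤ y.
  ·-monoʳ-≤ : ∀ {x y} z → x ≤ y → z · x ≤ z · y
  ·-monoʳ-≤ {x} {y} z p = subst (λ t → z · t ≤ z · y) (≤⇒⊓≡ p)
    (subst (_≤ z · y) (·-assoc z (((x ᵅ) · y) ᵅ) y) (·-monoˡ-≤ y (x·y≤x z _)))

  module DownSet {ℓ : Level} (I : Pred Carrier ℓ) (𝟘∈I : 𝟘 ∈ I) (i1 : I1 A I) where

    -- I is a down-set: x ≤ y gives x yᵅ = 0 ∈ I.
    ≤-closed : ∀ {x y} → x ≤ y → y ∈ I → x ∈ I
    ≤-closed {x} {y} p y∈I = i1 x y (subst I (sym (≤⇒·ᵅ≡𝟘 p)) 𝟘∈I) y∈I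

    -- I is closed under the Łukasiewicz sum p ⊕ q = (pᵅ qᵅ)ᵅ, because
    -- (p ⊕ q) qᵅ = p ⊓ qᵅ ≤ p.
    ⊕-closed : ∀ {p q} → p ∈ I → q ∈ I → ((p ᵅ) · (q ᵅ)) ᵅ ∈ I
    ⊕-closed {p} {q} p∈I q∈I = i1 _ q (≤-closed (⊓-lowerˡ p (q ᵅ)) p∈I) q∈I

  module InducedCongruence {ℓ : Level} (I : Pred Carrier ℓ) (𝟘∈I : 𝟘 ∈ I)
                           (i1 : I1 A I) (i2 : I2 A I) where
    open DownSet I 𝟘∈I i1

    θI : Rel Carrier ℓ
    θI = θ[_] A I

    -- (I2) at c = xᵅ, using x xᵅ = 0 and 0ᵅ z = z.
    θI⇒·ᵅ∈I : ∀ {x y} → θI x y → y · (x ᵅ) ∈ I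
    θI⇒·ᵅ∈I {x} {y} (h₁ , h₂) = subst I
      (trans (cong (λ t → t ᵅ · (y · (x ᵅ))) (x·xᵅ≡𝟘 x)) (𝟘ᵅ·x≡x _))
      (proj₁ (i2 x y h₁ h₂ (x ᵅ)))

    θI-ᵅ-cong : ∀ {x y} → θI x y → θI (x ᵅ) (y ᵅ)
    θI-ᵅ-cong {x} {y} (h₁ , h₂) =
      subst (λ t → t · (y ᵅ) ∈ I) (sym (ᵅ-involutive x)) (θI⇒·ᵅ∈I (h₂ , h₁)) ,
      subst (λ t → t · (x ᵅ) ∈ I) (sym (ᵅ-involutive y)) (θI⇒·ᵅ∈I (h₁ , h₂))

    θI-refl : ∀ {x} → θI x x
    θI-refl {x} = subst I (sym (xᵅ·x≡𝟘 x)) 𝟘∈I , subst I (sym (xᵅ·x≡𝟘 x)) 𝟘∈I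

    -- Transitivity: with p = c bᵅ and q = b aᵅ in I, the element p ⊕ q of I
    -- bounds aᵅ c, because (pᵅ qᵅ)(aᵅ c) ≤ pᵅ (bᵅ c) ≤ cᵅ c = 0.
    ᵅ·-trans : ∀ {a b c} → θI a b → θI b c → (a ᵅ) · c ∈ I
    ᵅ·-trans {a} {b} {c} ab bc = ≤-closed bound (⊕-closed (θI⇒·ᵅ∈I bc) (θI⇒·ᵅ∈I ab))
      where
      p = c · b ᵅ
      q = b · a ᵅ
      annihilates : ((p ᵅ) · (q ᵅ)) · ((a ᵅ) · c) ≤ 𝟘
      annihilates = begin
        ((p ᵅ) · (q ᵅ)) · ((a ᵅ) · c)  ≡⟨ ·-assoc (p ᵅ) (q ᵅ) _ ⟩
        (p ᵅ) · ((q ᵅ) · ((a ᵅ) · c))  ≡⟨ cong ((p ᵅ) ·_) (sym (·-assoc (q ᵅ) (a ᵅ) c)) ⟩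
        (p ᵅ) · (((q ᵅ) · (a ᵅ)) · c)  ≤⟨ ·-monoʳ-≤ (p ᵅ) (·-monoˡ-≤ c (·ᵅ-lowerˡ b a)) ⟩
        (p ᵅ) · ((b ᵅ) · c)            ≡⟨ sym (·-assoc (p ᵅ) (b ᵅ) c) ⟩
        ((p ᵅ) · (b ᵅ)) · c            ≤⟨ ·-monoˡ-≤ c (·ᵅ-lowerˡ c b) ⟩
        (c ᵅ) · c                      ≡⟨ xᵅ·x≡𝟘 c ⟩
        𝟘                              ∎
        where open ≤-Reasoning
      bound : (a ᵅ) · c ≤ ((p ᵅ) · (q ᵅ)) ᵅ
      bound = ᵅ·≡𝟘⇒≤ (subst (λ t → t · ((a ᵅ) · c) ≡ 𝟘) (sym (ᵅ-involutive _))
                             (≤𝟘⇒≡𝟘 annihilates))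

    θI-trans : ∀ {x y z} → θI x y → θI y z → θI x z
    θI-trans (h₁ , h₂) (k₁ , k₂) = ᵅ·-trans (h₁ , h₂) (k₁ , k₂) , ᵅ·-trans (k₂ , k₁) (h₂ , h₁)

    -- (I2) gives x u θI y u and y u θI y v.
    θI-·-cong : ∀ {x y u v} → θI x y → θI u v → θI (x · u) (y · v)
    θI-·-cong {x} {y} {u} {v} (h₁ , h₂) (k₁ , k₂) = θI-trans
      (proj₁ (i2 x y h₁ h₂ u) , proj₁ (i2 y x h₂ h₁ u))
      (proj₂ (i2 u v k₁ k₂ y) , proj₂ (i2 v u k₂ k₁ y))

    θI-isCongruence : IsCongruence A θI
    θI-isCongruence = record
      { isEquivalence = record
        { refl = θI-refl ; sym = λ (h₁ , h₂) → h₂ , h₁ ; trans = θI-trans }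
      ; +-cong = Compatible.+-cong θI θI-·-cong θI-ᵅ-cong
      ; ·-cong = θI-·-cong
      ; ᵅ-cong = θI-ᵅ-cong }

    -- x θI 0 means xᵅ 0 = 0 ∈ I and 0ᵅ x = x ∈ I.
    θI-zeroClass : _≐_ A I (zeroClass A θI)
    θI-zeroClass x =
      (λ x∈I → subst I (sym (·-zeroʳ _)) 𝟘∈I , subst I (sym (𝟘ᵅ·x≡x x)) x∈I) ,
      (λ (_ , h) → subst I (𝟘ᵅ·x≡x x) h)

  module CongruenceZeroClass {ℓ : Level} {θ : Rel Carrier ℓ} (C : IsCongruence A θ) where
    open IsCongruence C
    open IsEquivalence isEquivalence renaming (refl to θ-refl; sym to θ-sym; trans to θ-trans)

    θ⇒ᵅ·θ𝟘 : ∀ {x y} → θ x y → θ ((x ᵅ) · y) 𝟘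
    θ⇒ᵅ·θ𝟘 {x} {y} e = subst (θ ((x ᵅ) · y)) (xᵅ·x≡𝟘 y) (·-cong (ᵅ-cong e) θ-refl)

    ᵅ·θ𝟘⇒⊓θ : ∀ {x y} → θ ((x ᵅ) · y) 𝟘 → θ (x ⊓ y) y
    ᵅ·θ𝟘⇒⊓θ {x} {y} h = subst (θ (x ⊓ y)) (𝟘ᵅ·x≡x y) (·-cong (ᵅ-cong h) θ-refl)

    -- x θ y ⊓ x = x ⊓ y θ y.
    ᵅ·θ𝟘⇒θ : ∀ {x y} → θ ((x ᵅ) · y) 𝟘 → θ ((y ᵅ) · x) 𝟘 → θ x y
    ᵅ·θ𝟘⇒θ {x} {y} h k =
      θ-trans (θ-sym (subst (λ t → θ t x) (⊓-comm y x) (ᵅ·θ𝟘⇒⊓θ k))) (ᵅ·θ𝟘⇒⊓θ h)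

    module _ (I : Pred Carrier ℓ) (I≐[𝟘] : _≐_ A I (zeroClass A θ)) where

      -- y θ 0 gives yᵅ θ 1, hence x yᵅ θ x; as x yᵅ θ 0, also x θ 0.
      zeroClass-I1 : I1 A I
      zeroClass-I1 x y h y∈I = proj₂ (I≐[𝟘] x) (θ-trans (θ-sym x·yᵅθx) (proj₁ (I≐[𝟘] _) h))
        where
        x·yᵅθx : θ (x · (y ᵅ)) x
        x·yᵅθx = subst (θ (x · (y ᵅ))) (·-identityʳ x)
          (·-cong θ-refl (subst (θ (y ᵅ)) 𝟘ᵅ≡𝟙 (ᵅ-cong (proj₁ (I≐[𝟘] y) y∈I))))

      zeroClass-I2 : I2 A I
      zeroClass-I2 x y h₁ h₂ c =
        inI (θ⇒ᵅ·θ𝟘 (·-cong xθy θ-refl)) , inI (θ⇒ᵅ·θ𝟘 (·-cong θ-refl xθy))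
        where
        inI : ∀ {z} → θ z 𝟘 → z ∈ I
        inI {z} = proj₂ (I≐[𝟘] z)
        xθy : θ x y
        xθy = ᵅ·θ𝟘⇒θ (proj₁ (I≐[𝟘] _) h₁) (proj₁ (I≐[𝟘] _) h₂)

corollary1 : {a ℓ : Level} (A : LukasiewiczSemiring a) →
    let open LukasiewiczSemiring A in
    (I : Pred Carrier ℓ) → 𝟘 ∈ I →
    ((Σ (Rel Carrier ℓ) λ θ → IsCongruence A θ × (_≐_ A I (zeroClass A θ)))
    ⇔ (I1 A I × I2 A I))
    × ((I1 A I × I2 A I) → IsCongruence A (θ[_] A I) × (_≐_ A I (zeroClass A (θ[_] A I))))
corollary1 A I 𝟘∈I = mk⇔ zeroClass⇒I1I2 (λ i → θ[_] A I , induced i) , induced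
  where
  open Ideals A
  zeroClass⇒I1I2 : (Σ (Rel _ _) λ θ → IsCongruence A θ × (_≐_ A I (zeroClass A θ))) →
                   I1 A I × I2 A I
  zeroClass⇒I1I2 (θ , C , I≐[𝟘]) = zeroClass-I1 I I≐[𝟘] , zeroClass-I2 I I≐[𝟘]
    where open CongruenceZeroClass C
  induced : I1 A I × I2 A I → IsCongruence A (θ[_] A I) × (_≐_ A I (zeroClass A (θ[_] A I)))
  induced (i1 , i2) = θI-isCongruence , θI-zeroClass
    where open InducedCongruence I 𝟘∈I i1 i2
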